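{- Given an $n$-node connected simple undirected graph $G$ with a distinguished node $s$, in the insertion-only streaming model a BFS tree of $G$ rooted at $s$ can be found deterministically in $p$ passes using $\tilde{O}(n^2/p)$ space, for every $p \in [1, n]$.
   Context: Insertion-only streaming model: the edges of the input graph arrive as a stream of insertions which may be read sequentially in several passes; space is in bits. $\tilde{O}(k)$ denotes $O(k\cdot\mathrm{poly}\log n)$. -}

module Defs where

open import Data.Nat using (ℕ; zero; suc; _+_; _*_; _^_; _≤_)
open import Data.Nat.Logarithm using (⌊log₂_⌋)
open import Data.Fin using (Fin)
open import Data.Bool using (Bool; T)
open import Data.Vec using (Vec)
open import Data.List using (List; foldl)
open import Data.List.Relation.Unary.All using (All)
open import Data.List.Relation.Unary.AllPairs using (AllPairs)
open import Data.List.Membership.Propositional using (_∈_)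
open import Data.Maybe using (Maybe; just; nothing)
open import Data.Product using (Σ; ∃; ∃-syntax; _×_; _,_)
open import Data.Sum using (_⊎_)
open import Relation.Nullary using (¬_)
open import Relation.Binary.PropositionalEquality using (_≡_; _≢_)

record Graph (n : ℕ) : Set where
  field
    adj    : Fin n → Fin n → Bool
    sym    : ∀ u v → adj u v ≡ adj v u
    irrefl : ∀ u → adj u u ≡ Data.Bool.false

Adj : ∀ {n} → Graph n → Fin n → Fin n → Set
Adj G u v = T (Graph.adj G u v)

data Walk {n} (G : Graph n) : Fin n → Fin n → ℕ → Set where
  here : ∀ {u} → Walk G u u zero
  step : ∀ {u w v k} → Adj G u w → Walk G w v k → Walk G u v (suc k)

Connected : ∀ {n} → Graph n → Set
Connected G = ∀ u v → ∃[ k ] Walk G u v k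

IsDist : ∀ {n} → Graph n → Fin n → Fin n → ℕ → Set
IsDist G u v d = Walk G u v d × (∀ k → Walk G u v k → d ≤ k)

IsBFSTree : ∀ {n} → Graph n → Fin n → (Fin n → Maybe (Fin n)) → Set
IsBFSTree G s par =
  (par s ≡ nothing) ×
  (∀ v → v ≢ s → ∃[ u ] (par v ≡ just u × Adj G u v ×
                          ∃[ d ] (IsDist G s u d × IsDist G s v (suc d))))

-- Edge streams (insertion-only): a list of edges, each an ordered pair
-- representing an undirected edge; every edge of G appears exactly once.

Edge : ℕ → Set
Edge n = Fin n × Fin n

SameEdge : ∀ {n} → Edge n → Edge n → Set
SameEdge (u , v) (u' , v') = (u ≡ u' × v ≡ v') ⊎ (u ≡ v' × v ≡ u')

IsEdgeStream : ∀ {n} → Graph n → List (Edge n) → Set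
IsEdgeStream G σ =
  All (λ e → Adj G (Data.Product.proj₁ e) (Data.Product.proj₂ e)) σ ×
  (∀ u v → Adj G u v → ((u , v) ∈ σ) ⊎ ((v , u) ∈ σ)) ×
  AllPairs (λ e f → ¬ SameEdge e f) σ

-- The whole memory is a bit string of length S; it is initialised
-- from the root s, updated by an arbitrary (deterministic) function per
-- arriving edge, updated at the end of each pass, and the output is a
-- function of the final memory.

record StreamAlg (n S : ℕ) : Set where
  field
    init    : Fin n → Vec Bool S
    update  : Vec Bool S → Edge n → Vec Bool S
    endPass : Vec Bool S → Vec Bool S
    output  : Vec Bool S → (Fin n → Maybe (Fin n))

onePass : ∀ {n S} → StreamAlg n S → List (Edge n) → Vec Bool S → Vec Bool S
onePass A σ m = StreamAlg.endPass A (foldl (StreamAlg.update A) m σ)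

runPasses : ∀ {n S} → StreamAlg n S → ℕ → List (Edge n) → Vec Bool S → Vec Bool S
runPasses A zero    σ m = m
runPasses A (suc p) σ m = runPasses A p σ (onePass A σ m)

ComputesBFS : ∀ {n S} → StreamAlg n S → ℕ → Set
ComputesBFS {n} A p =
  (G : Graph n) (s : Fin n) (σ : List (Edge n)) →
  Connected G → IsEdgeStream G σ →
  IsBFSTree G s (StreamAlg.output A (runPasses A p σ (StreamAlg.init A s)))

polylog : ℕ → ℕ → ℕ
polylog k n = suc ⌊log₂ n ⌋ ^ k

module Submission where

-- The algorithm keeps Bellman–Ford distance labels with parent pointers. In every pass it
-- relaxes each streamed edge and stores, for every vertex, up to τ + 1 of its incident
-- edges; at the end of the pass it relaxes the stored edges for 3n rounds. A vertex whose
-- buffer did not fill up has all of its edges stored, so along a shortest path one pass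
-- carries the correct labels across one streamed edge and then across every following
-- edge with an endpoint whose buffer is not full; it can only stop at a full ("heavy")
-- vertex, whose degree exceeds τ. A walk from s on which some z is adjacent to two
-- vertices three or more positions apart can be shortened through z; on a walk without
-- such shortcuts every vertex is adjacent to at most three consecutive walk vertices,
-- so the degrees along the walk sum to at most 3n. With τ + 1 > 3n/p such a walk thus
-- contains fewer than p heavy vertices, and p passes suffice. The state consists of n
-- labels, n parents and n(τ + 1) buffered vertex names of O(log n) bits each, that is,
-- O((n²/p) log n) bits for τ = ⌊3n/p⌋.

open import Defs
open import Data.Nat using (ℕ; _*_; _≤_; _^_; suc)
open import Data.Product using (Σ; ∃; ∃-syntax; _×_; _,_)

open import Data.Bool using (Bool; true; false; T; T?; if_then_else_; _∨_)
open import Data.Bool.Properties using (∨-zeroʳ)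
open import Data.Empty using (⊥; ⊥-elim)
open import Data.Fin as Fin using (Fin; toℕ; fromℕ; fromℕ<; inject≤; remQuot; combine)
open import Data.Fin.Properties as Finₚ
  using (toℕ<n; toℕ-inject₁; toℕ-fromℕ; toℕ-fromℕ<; toℕ-inject≤; combine-remQuot)
open import Data.List as List using (List; foldl; allFin; concatMap)
open import Data.List.Membership.Propositional using (_∈_)
open import Data.List.Membership.Propositional.Properties using (∈-concatMap⁺; ∈-concatMap⁻; ∈-allFin; ∈-∃++)
open import Data.List.Properties using (foldl-++)
open import Data.List.Relation.Unary.All as All using (All)
open import Data.List.Relation.Unary.Any as Any using (here; there)
open import Data.Maybe using (Maybe; just; nothing)
open import Data.Nat using (zero; _+_; _∸_; _<_; _⊓_; _≟_; _≡ᵇ_; _≤?_; _<?_; z≤n; s≤s; s≤s⁻¹; NonZero; ⌊_/2⌋)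
open import Data.Nat.DivMod using (_/_; _%_; m≡m%n+[m/n]*n; m%n<n; m/n*n≤m)
open import Data.Nat.GeneralisedArithmetic using (fold; iterate; fold-+; iterate-is-fold)
open import Data.Nat.Induction using (<-rec)
open import Data.Nat.Logarithm using (⌊log₂_⌋; ⌊log₂⌋-mono-≤; ⌊log₂[2^n]⌋≡n; ⌊log₂⌊n/2⌋⌋≡⌊log₂n⌋∸1)
open import Data.Nat.Properties
open import Data.Nat.Solver using (module +-*-Solver)
open import Data.Product as Product using (proj₁; proj₂; uncurry; ∃₂)
open import Data.Sum as Sum using (_⊎_; inj₁; inj₂)
open import Data.Vec as Vec using (Vec; []; _∷_; _++_; take; drop; replicate; lookup; updateAt)
open import Data.Vec.Properties
  using (take++drop≡id; ++-injective; lookup∘updateAt; lookup∘updateAt′; lookup-replicate)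
open import Function using (_∘_)
open import Relation.Binary.Definitions using (tri<; tri≈; tri>)
open import Relation.Binary.PropositionalEquality
open import Relation.Nullary using (¬_; Dec; yes; no; does; contradiction)
open import Relation.Nullary.Decidable using (_×-dec_; ¬?; _⊎-dec_; decidable-stable)
open import Algebra.Properties.CommutativeMonoid.Sum +-0-commutativeMonoid
  using (sum; sum-syntax; sum-init-last; sum-cong-≗; sum-replicate-zero; ∑-comm)
open +-*-Solver using (solve; _:+_; _:*_; con; _:=_)

-- Finite sums and folds

ind : Bool → ℕ
ind true  = 1
ind false = 0

ind≤1 : ∀ b → ind b ≤ 1
ind≤1 true  = ≤-refl
ind≤1 false = z≤n

T⇒ind≡1 : ∀ {b} → T b → ind b ≡ 1
T⇒ind≡1 {true} _ = refl

¬T⇒ind≡0 : ∀ {b} → ¬ T b → ind b ≡ 0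
¬T⇒ind≡0 {true}  ¬t = ⊥-elim (¬t _)
¬T⇒ind≡0 {false} _  = refl

sum-mono-≤ : ∀ {n} {f g : Fin n → ℕ} → (∀ i → f i ≤ g i) → sum f ≤ sum g
sum-mono-≤ {zero}  _   = z≤n
sum-mono-≤ {suc n} f≤g = +-mono-≤ (f≤g Fin.zero) (sum-mono-≤ (f≤g ∘ Fin.suc))

sum-≤-* : ∀ {n} {f : Fin n → ℕ} c → (∀ i → f i ≤ c) → sum f ≤ n * c
sum-≤-* {zero}  c _   = z≤n
sum-≤-* {suc n} c f≤c = +-mono-≤ (f≤c Fin.zero) (sum-≤-* c (f≤c ∘ Fin.suc))

n≤sum-of-positive : ∀ {n} {f : Fin n → ℕ} → (∀ i → 1 ≤ f i) → n ≤ sum f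
n≤sum-of-positive {zero}  _     = z≤n
n≤sum-of-positive {suc n} 1≤f = +-mono-≤ (1≤f Fin.zero) (n≤sum-of-positive (1≤f ∘ Fin.suc))

sum-*ʳ : ∀ {n} (f : Fin n → ℕ) c → sum f * c ≡ ∑[ i < n ] (f i * c)
sum-*ʳ {zero}  f c = refl
sum-*ʳ {suc n} f c =
  trans (*-distribʳ-+ c (f Fin.zero) (sum (f ∘ Fin.suc))) (cong (f Fin.zero * c +_) (sum-*ʳ (f ∘ Fin.suc) c))

term≤sum : ∀ {n} (f : Fin n → ℕ) i → f i ≤ sum f
term≤sum f Fin.zero    = m≤m+n _ _
term≤sum f (Fin.suc i) = ≤-trans (term≤sum (f ∘ Fin.suc) i) (m≤n+m _ _)

sum-increment : ∀ {n} (f g : Fin n → ℕ) i → g i ≡ suc (f i) → (∀ j → j ≢ i → g j ≡ f j) →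
                sum g ≡ suc (sum f)
sum-increment f g Fin.zero gi≡ g≡f =
  cong₂ _+_ gi≡ (sum-cong-≗ (λ j → g≡f (Fin.suc j) (λ ())))
sum-increment f g (Fin.suc i) gi≡ g≡f =
  trans (cong₂ _+_ (g≡f Fin.zero (λ ()))
                   (sum-increment (f ∘ Fin.suc) (g ∘ Fin.suc) i gi≡ (λ j j≢i → g≡f (Fin.suc j) (j≢i ∘ Finₚ.suc-injective))))
        (+-suc _ _)

count-below : ∀ {K} (b : Fin K → Bool) w → (∀ i → T (b i) → toℕ i < w) → ∑[ i < K ] ind (b i) ≤ w
count-below {zero}  b w       _     = z≤n
count-below {suc K} b zero    below with b Fin.zero | below Fin.zero
... | true  | b₀<0 = ⊥-elim (n≮0 (b₀<0 _))
... | false | _    = count-below (b ∘ Fin.suc) zero (λ i t → ≤-trans (n≤1+n _) (below (Fin.suc i) t))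
count-below {suc K} b (suc w) below =
  +-mono-≤ (ind≤1 (b Fin.zero)) (count-below (b ∘ Fin.suc) w (λ i t → s≤s⁻¹ (below (Fin.suc i) t)))

count-clustered : ∀ {K} (b : Fin K → Bool) →
                  (∀ i j → T (b i) → T (b j) → toℕ j ≤ 2 + toℕ i) → ∑[ i < K ] ind (b i) ≤ 3
count-clustered {zero}  b close = z≤n
count-clustered {suc K} b close with T? (b Fin.zero)
... | yes b₀ = count-below b 3 (λ j bj → s≤s (close Fin.zero j b₀ bj))
... | no ¬b₀ = ≤-trans (+-monoˡ-≤ (∑[ i < K ] ind (b (Fin.suc i))) (≤-reflexive (¬T⇒ind≡0 ¬b₀)))
                 (count-clustered (b ∘ Fin.suc) (λ i j bi bj → s≤s⁻¹ (close (Fin.suc i) (Fin.suc j) bi bj)))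

sumTo : ℕ → (ℕ → ℕ) → ℕ
sumTo K g = ∑[ i < K ] g (toℕ i)

sumTo-suc : ∀ K g → sumTo (suc K) g ≡ sumTo K g + g K
sumTo-suc K g = trans (sum-init-last {K} (g ∘ toℕ))
  (cong₂ _+_ (sum-cong-≗ {K} (λ i → cong g (toℕ-inject₁ i))) (cong g (toℕ-fromℕ K)))

sumTo-monoˡ-≤ : ∀ {K K′} g → K ≤ K′ → sumTo K g ≤ sumTo K′ g
sumTo-monoˡ-≤ {K} g K≤K′ with m≤n⇒∃[o]m+o≡n K≤K′
... | o , refl = grow o
  where
  grow : ∀ o → sumTo K g ≤ sumTo (K + o) g
  grow zero    = ≤-reflexive (cong (λ m → sumTo m g) (sym (+-identityʳ K)))
  grow (suc o) = begin
    sumTo K g                   ≤⟨ grow o ⟩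
    sumTo (K + o) g             ≤⟨ m≤m+n _ _ ⟩
    sumTo (K + o) g + g (K + o) ≡⟨ sumTo-suc (K + o) g ⟨
    sumTo (suc (K + o)) g       ≡⟨ cong (λ m → sumTo m g) (+-suc K o) ⟨
    sumTo (K + suc o) g         ∎
    where open ≤-Reasoning

q≤j⇒j≮q+0 : ∀ {q j} → q ≤ j → ¬ j < q + 0
q≤j⇒j≮q+0 {q} q≤j j<q+0 = <⇒≱ (subst (_ <_) (+-identityʳ q) j<q+0) q≤j

foldl-preserves : ∀ {A B : Set} (P : A → Set) {f : A → B → A} →
                  (∀ x e → P x → P (f x e)) → ∀ xs {x} → P x → P (foldl f x xs)
foldl-preserves P pres List.[]         Px = Px
foldl-preserves P pres (e List.∷ xs) Px = foldl-preserves P pres xs (pres _ e Px)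

foldl-preserves-All : ∀ {A B : Set} (P : A → Set) {Q : B → Set} {f : A → B → A} →
                      (∀ {x e} → Q e → P x → P (f x e)) → ∀ {xs} → All Q xs → ∀ {x} → P x → P (foldl f x xs)
foldl-preserves-All P pres All.[]         Px = Px
foldl-preserves-All P pres (Qe All.∷ Qxs) Px = foldl-preserves-All P pres Qxs (pres Qe Px)

foldl-∈ : ∀ {A B : Set} (f : A → B → A) x {e xs} → e ∈ xs →
          ∃₂ λ ys zs → foldl f x xs ≡ foldl f (f (foldl f x ys) e) zs
foldl-∈ f x e∈xs with ∈-∃++ e∈xs
... | ys , zs , refl = ys , zs , foldl-++ f x ys _

foldl-× : ∀ {A B C : Set} (f : A → C → A) (g : B → C → B) xs a b →
          foldl (λ st e → f (proj₁ st) e , g (proj₂ st) e) (a , b) xs ≡ (foldl f a xs , foldl g b xs)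
foldl-× f g List.[]         a b = refl
foldl-× f g (e List.∷ xs) a b = foldl-× f g xs (f a e) (g b e)

updateAt-preserves : ∀ {A : Set} {m} (P : A → Set) (xs : Vec A m) i j {f : A → A} →
                     (∀ x → P x → P (f x)) → P (lookup xs j) → P (lookup (updateAt xs i f) j)
updateAt-preserves P xs i j pres Pxⱼ with j Fin.≟ i
... | yes refl = subst P (sym (lookup∘updateAt j xs)) (pres _ Pxⱼ)
... | no j≢i   = subst P (sym (lookup∘updateAt′ j i j≢i xs)) Pxⱼ

updateAt-pointwise : ∀ {A : Set} {m} (P : Fin m → A → Set) (xs : Vec A m) i {f : A → A} →
                     (∀ j → P j (lookup xs j)) → P i (f (lookup xs i)) → ∀ j → P j (lookup (updateAt xs i f) j)
updateAt-pointwise P xs i Pxs Pfi j with j Fin.≟ i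
... | yes refl = subst (P j) (sym (lookup∘updateAt j xs)) Pfi
... | no j≢i   = subst (P j) (sym (lookup∘updateAt′ j i j≢i xs)) (Pxs j)

-- Bit encodings and machines with structured state

record Encoding (A : Set) (b : ℕ) : Set where
  field
    encode        : A → Vec Bool b
    decode        : Vec Bool b → A
    decode-encode : ∀ x → decode (encode x) ≡ x
open Encoding

retract-encoding : ∀ {A C b} (f : A → C) (g : C → A) → (∀ x → g (f x) ≡ x) →
                   Encoding C b → Encoding A b
retract-encoding f g g∘f E = record
  { encode        = encode E ∘ f
  ; decode        = g ∘ decode E
  ; decode-encode = λ x → trans (cong g (decode-encode E (f x))) (g∘f x)
  }

take-drop-++ : ∀ {X : Set} {a c} (xs : Vec X a) (ys : Vec X c) →
               take a (xs ++ ys) ≡ xs × drop a (xs ++ ys) ≡ ys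
take-drop-++ {a = a} xs ys = ++-injective (take a (xs ++ ys)) xs (take++drop≡id a (xs ++ ys))

×-encoding : ∀ {A C a c} → Encoding A a → Encoding C c → Encoding (A × C) (a + c)
×-encoding {a = a} EA EC = record
  { encode        = λ (x , y) → encode EA x ++ encode EC y
  ; decode        = λ v → decode EA (take a v) , decode EC (drop a v)
  ; decode-encode = λ (x , y) →
      let take≡ , drop≡ = take-drop-++ (encode EA x) (encode EC y)
      in cong₂ _,_ (trans (cong (decode EA) take≡) (decode-encode EA x))
                   (trans (cong (decode EC) drop≡) (decode-encode EC y))
  }

vec-encoding : ∀ {A b} m → Encoding A b → Encoding (Vec A m) (m * b)
vec-encoding zero    E = record { encode = λ _ → [] ; decode = λ _ → [] ; decode-encode = λ { [] → refl } }
vec-encoding (suc m) E =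
  retract-encoding (λ { (x ∷ xs) → x , xs }) (uncurry _∷_) (λ { (x ∷ xs) → refl })
                   (×-encoding E (vec-encoding m E))

bit-encoding : Encoding (Fin 2) 1
bit-encoding = record
  { encode        = λ { Fin.zero → false ∷ [] ; (Fin.suc _) → true ∷ [] }
  ; decode        = λ { (false ∷ []) → Fin.zero ; (true ∷ []) → Fin.suc Fin.zero }
  ; decode-encode = λ { Fin.zero → refl ; (Fin.suc Fin.zero) → refl }
  }

binary-encoding : ∀ B → Encoding (Fin (2 ^ B)) B
binary-encoding zero    = record { encode = λ _ → [] ; decode = λ _ → Fin.zero ; decode-encode = λ { Fin.zero → refl } }
binary-encoding (suc B) =
  retract-encoding (remQuot (2 ^ B)) (uncurry combine) (combine-remQuot {2} (2 ^ B))
                   (×-encoding bit-encoding (binary-encoding B))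

-- Decoding clamps out-of-range codes to the largest element.
fin-encoding : ∀ {m} B → suc m ≤ 2 ^ B → Encoding (Fin (suc m)) B
fin-encoding {m} B m<2^B = retract-encoding (λ x → inject≤ x m<2^B) clamp clamp-inject≤ (binary-encoding B)
  where
  clamp : Fin (2 ^ B) → Fin (suc m)
  clamp y = fromℕ< (s≤s (m⊓n≤n (toℕ y) m))
  clamp-inject≤ : ∀ x → clamp (inject≤ x m<2^B) ≡ x
  clamp-inject≤ x = Finₚ.toℕ-injective (begin
    toℕ (clamp (inject≤ x m<2^B)) ≡⟨ toℕ-fromℕ< _ ⟩
    toℕ (inject≤ x m<2^B) ⊓ m     ≡⟨ cong (_⊓ m) (toℕ-inject≤ x m<2^B) ⟩
    toℕ x ⊓ m                     ≡⟨ m≤n⇒m⊓n≡m (s≤s⁻¹ (toℕ<n x)) ⟩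
    toℕ x                         ∎)
    where open ≡-Reasoning

maybe-encoding : ∀ {n} B → suc n ≤ 2 ^ B → Encoding (Maybe (Fin n)) B
maybe-encoding B n<2^B = retract-encoding
  (λ { nothing → Fin.zero ; (just i) → Fin.suc i })
  (λ { Fin.zero → nothing ; (Fin.suc i) → just i })
  (λ { nothing → refl ; (just _) → refl })
  (fin-encoding B n<2^B)

record Machine (n : ℕ) (St : Set) : Set where
  field
    init    : Fin n → St
    update  : St → Edge n → St
    endPass : St → St
    output  : St → Fin n → Maybe (Fin n)

module _ {n} {St : Set} (A : Machine n St) where
  open Machine A

  run : ℕ → List (Edge n) → St → St
  run zero    σ x = x
  run (suc p) σ x = run p σ (endPass (foldl update x σ))

  MachineComputesBFS : ℕ → Set
  MachineComputesBFS p =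
    (G : Graph n) (s : Fin n) (σ : List (Edge n)) →
    Connected G → IsEdgeStream G σ → IsBFSTree G s (output (run p σ (init s)))

  compile : ∀ {S} → Encoding St S → StreamAlg n S
  compile E = record
    { init    = encode E ∘ init
    ; update  = λ m e → encode E (update (decode E m) e)
    ; endPass = encode E ∘ endPass ∘ decode E
    ; output  = output ∘ decode E
    }

  module _ {S} (E : Encoding St S) where
    foldl-compile : ∀ σ x → foldl (StreamAlg.update (compile E)) (encode E x) σ ≡ encode E (foldl update x σ)
    foldl-compile List.[]       x = refl
    foldl-compile (e List.∷ σ) x rewrite decode-encode E x = foldl-compile σ (update x e)

    run-compile : ∀ p σ x → runPasses (compile E) p σ (encode E x) ≡ encode E (run p σ x)
    run-compile zero    σ x = refl
    run-compile (suc p) σ x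
      rewrite foldl-compile σ x | decode-encode E (foldl update x σ) = run-compile p σ _

    compile-computesBFS : ∀ {p} → MachineComputesBFS p → ComputesBFS (compile E) p
    compile-computesBFS {p} bfs G s σ conn stream =
      subst (IsBFSTree G s) (sym (begin
        output (decode E (runPasses (compile E) p σ (encode E (init s)))) ≡⟨ cong (output ∘ decode E) (run-compile p σ (init s)) ⟩
        output (decode E (encode E (run p σ (init s))))                   ≡⟨ cong output (decode-encode E _) ⟩
        output (run p σ (init s))                                         ∎))
        (bfs G s σ conn stream)
      where open ≡-Reasoning

-- Walks, shortcuts and degree sums

adj-sym : ∀ {n} (G : Graph n) {u v} → Adj G u v → Adj G v u
adj-sym G {u} {v} = subst T (Graph.sym G u v)

walk-snoc : ∀ {n} {G : Graph n} {a b c k} → Walk G a b k → Adj G b c → Walk G a c (suc k)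
walk-snoc here         b~c = step b~c here
walk-snoc (step a~ w) b~c = step a~ (walk-snoc w b~c)

module _ {n} (G : Graph n) where

  degree : Fin n → ℕ
  degree v = ∑[ w < n ] ind (Graph.adj G w v)

  adj⇒1≤degree : ∀ {u v} → Adj G u v → 1 ≤ degree v
  adj⇒1≤degree {u} {v} u~v =
    ≤-trans (≤-reflexive (sym (T⇒ind≡1 u~v))) (term≤sum (λ w → ind (Graph.adj G w v)) u)

  record IndexedWalk (a v : Fin n) (k : ℕ) : Set where
    field
      at     : ℕ → Fin n
      at-0   : at 0 ≡ a
      at-k   : at k ≡ v
      adj-at : ∀ i → i < k → Adj G (at i) (at (suc i))
  open IndexedWalk public

  toIndexed : ∀ {a v k} → Walk G a v k → IndexedWalk a v k
  toIndexed {a} here = record { at = λ _ → a ; at-0 = refl ; at-k = refl ; adj-at = λ _ () }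
  toIndexed {a} (step a~w W) = record { at = at′ ; at-0 = refl ; at-k = at-k W′ ; adj-at = adj-at′ }
    where
    W′ = toIndexed W
    at′ : ℕ → Fin n
    at′ zero    = a
    at′ (suc i) = at W′ i
    adj-at′ : ∀ i → i < suc _ → Adj G (at′ i) (at′ (suc i))
    adj-at′ zero    _         = subst (Adj G a) (sym (at-0 W′)) a~w
    adj-at′ (suc i) (s≤s i<k) = adj-at W′ i i<k

  Shortcut : ∀ {a v k} → IndexedWalk a v k → Set
  Shortcut {k = k} W = ∃ λ i → i < suc k × ∃ λ j → j < suc k × 3 + i ≤ j ×
                       ∃ λ z → Adj G z (at W i) × Adj G z (at W j)

  ShortcutFree : ∀ {a v k} → IndexedWalk a v k → Set
  ShortcutFree W = ¬ Shortcut W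

  shortcut? : ∀ {a v k} (W : IndexedWalk a v k) → Dec (Shortcut W)
  shortcut? {k = k} W = anyUpTo? (λ i → anyUpTo? (λ j → (3 + i ≤? j) ×-dec
                          Finₚ.any? (λ z → T? (Graph.adj G z (at W i)) ×-dec T? (Graph.adj G z (at W j))))
                          (suc k)) (suc k)

  -- The bypass replaces the 2 + e vertices strictly between positions i and 3 + i + e by z.
  module Bypass {a v k} (W : IndexedWalk a v k) {i e r z}
                (k≡ : 3 + i + e + r ≡ k) (z~i : Adj G z (at W i)) (z~j : Adj G z (at W (3 + i + e))) where

    at′ : ℕ → Fin n
    at′ m with <-cmp m (suc i)
    ... | tri< _ _ _ = at W m
    ... | tri≈ _ _ _ = z
    ... | tri> _ _ _ = at W (m + suc e)

    at′-below : ∀ m → m < suc i → at′ m ≡ at W m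
    at′-below m m<1+i with <-cmp m (suc i)
    ... | tri< _ _ _   = refl
    ... | tri≈ ¬m< _ _ = contradiction m<1+i ¬m<
    ... | tri> ¬m< _ _ = contradiction m<1+i ¬m<

    at′-middle : at′ (suc i) ≡ z
    at′-middle with <-cmp (suc i) (suc i)
    ... | tri< _ ¬≡ _ = contradiction refl ¬≡
    ... | tri≈ _ _ _  = refl
    ... | tri> _ ¬≡ _ = contradiction refl ¬≡

    at′-above : ∀ m → suc i < m → at′ m ≡ at W (m + suc e)
    at′-above m 1+i<m with <-cmp m (suc i)
    ... | tri< _ _ ¬> = contradiction 1+i<m ¬>
    ... | tri≈ _ _ ¬> = contradiction 1+i<m ¬>
    ... | tri> _ _ _  = refl

    2+i+r+1+e≡k : 2 + i + r + suc e ≡ k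
    2+i+r+1+e≡k = trans (solve 3 (λ i e r → con 2 :+ i :+ r :+ (con 1 :+ e) := con 3 :+ i :+ e :+ r) refl i e r) k≡

    shift-bound : ∀ m → m < 2 + i + r → m + suc e < k
    shift-bound m m< = subst (m + suc e <_) 2+i+r+1+e≡k (+-monoˡ-< (suc e) m<)

    relative-position : ∀ m → m < i ⊎ m ≡ i ⊎ m ≡ suc i ⊎ suc i < m
    relative-position m with <-cmp m (suc i)
    ... | tri> _ _ 1+i<m = inj₂ (inj₂ (inj₂ 1+i<m))
    ... | tri≈ _ m≡1+i _ = inj₂ (inj₂ (inj₁ m≡1+i))
    ... | tri< m<1+i _ _ with m<1+n⇒m<n∨m≡n m<1+i
    ...   | inj₁ m<i = inj₁ m<i
    ...   | inj₂ m≡i = inj₂ (inj₁ m≡i)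

    adj-at′ : ∀ m → m < 2 + i + r → Adj G (at′ m) (at′ (suc m))
    adj-at′ m m< with relative-position m
    ... | inj₁ m<i = subst₂ (Adj G) (sym (at′-below m (m<n⇒m<1+n m<i))) (sym (at′-below (suc m) (s≤s m<i)))
                       (adj-at W m (≤-<-trans (m≤m+n m (suc e)) (shift-bound m m<)))
    ... | inj₂ (inj₁ refl) = subst₂ (Adj G) (sym (at′-below m ≤-refl)) (sym at′-middle) (adj-sym G z~i)
    ... | inj₂ (inj₂ (inj₁ refl)) = subst₂ (Adj G) (sym at′-middle) (sym (at′-above (2 + i) ≤-refl))
                                      (subst (Adj G z ∘ at W) (cong (suc ∘ suc) (sym (+-suc i e))) z~j)
    ... | inj₂ (inj₂ (inj₂ 1+i<m)) = subst₂ (Adj G) (sym (at′-above m 1+i<m)) (sym (at′-above (suc m) (m<n⇒m<1+n 1+i<m)))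
                                        (adj-at W (m + suc e) (shift-bound m m<))

    bypass : IndexedWalk a v (2 + i + r)
    bypass = record
      { at     = at′
      ; at-0   = trans (at′-below 0 (s≤s z≤n)) (at-0 W)
      ; at-k   = trans (at′-above (2 + i + r) (s≤s (s≤s (m≤m+n i r))))
                       (trans (cong (at W) 2+i+r+1+e≡k) (at-k W))
      ; adj-at = adj-at′
      }

    bypass-shorter : 2 + i + r < k
    bypass-shorter = subst (2 + i + r <_) 2+i+r+1+e≡k (m<m+n _ (s≤s z≤n))

  shorten : ∀ {a v k} (W : IndexedWalk a v k) → Shortcut W → ∃ λ k′ → k′ < k × IndexedWalk a v k′
  shorten {k = k} W (i , _ , j , j<1+k , 3+i≤j , z , z~i , z~j)
    with m≤n⇒∃[o]m+o≡n 3+i≤j | m≤n⇒∃[o]m+o≡n (s≤s⁻¹ j<1+k)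
  ... | e , refl | r , j+r≡k = 2 + i + r , bypass-shorter , bypass
    where open Bypass W j+r≡k z~i z~j

  neighbours-clustered : ∀ {a v k} (W : IndexedWalk a v k) → ShortcutFree W → ∀ z (i j : Fin (suc k)) →
                         T (Graph.adj G z (at W (toℕ i))) → T (Graph.adj G z (at W (toℕ j))) →
                         toℕ j ≤ 2 + toℕ i
  neighbours-clustered W free z i j z~i z~j with toℕ j ≤? 2 + toℕ i
  ... | yes j≤2+i = j≤2+i
  ... | no  j≰2+i = contradiction (toℕ i , toℕ<n i , toℕ j , toℕ<n j , ≰⇒> j≰2+i , z , z~i , z~j) free

  degree-sum≤3n : ∀ {a v k} (W : IndexedWalk a v k) → ShortcutFree W →
                  sumTo (suc k) (degree ∘ at W) ≤ 3 * n
  degree-sum≤3n {k = k} W free = begin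
    sumTo (suc k) (degree ∘ at W)                                 ≡⟨ ∑-comm {suc k} {n} (λ i w → ind (Graph.adj G w (at W (toℕ i)))) ⟩
    ∑[ w < n ] ∑[ i < suc k ] ind (Graph.adj G w (at W (toℕ i))) ≤⟨ sum-≤-* 3 (λ w → count-clustered _ (neighbours-clustered W free w)) ⟩
    n * 3                                                         ≡⟨ *-comm n 3 ⟩
    3 * n                                                         ∎
    where open ≤-Reasoning

  length<degree-sum : ∀ {a v k} (W : IndexedWalk a v k) → 1 ≤ k → k < sumTo (suc k) (degree ∘ at W)
  length<degree-sum {k = suc k} W _ = n≤sum-of-positive has-neighbour
    where
    has-neighbour : ∀ (i : Fin (suc (suc k))) → 1 ≤ degree (at W (toℕ i))
    has-neighbour i with toℕ i ≟ suc k
    ... | yes i≡1+k = adj⇒1≤degree (subst (Adj G (at W k) ∘ at W) (sym i≡1+k) (adj-at W k ≤-refl))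
    ... | no  i≢1+k = adj⇒1≤degree (adj-sym G (adj-at W (toℕ i) (≤∧≢⇒< (s≤s⁻¹ (toℕ<n i)) i≢1+k)))

-- Bounded neighbour buffers

module _ {n : ℕ} where

  Buffer : ℕ → Set
  Buffer m = Vec (Maybe (Fin n)) m

  holds : ∀ {m} → Fin n → Buffer m → Bool
  holds u []            = false
  holds u (nothing ∷ b) = holds u b
  holds u (just w ∷ b)  = does (w Fin.≟ u) ∨ holds u b

  free : ∀ {m} → Buffer m → ℕ
  free []            = 0
  free (nothing ∷ b) = suc (free b)
  free (just _ ∷ b)  = free b

  fill : ∀ {m} → Fin n → Buffer m → Buffer m
  fill u []            = []
  fill u (nothing ∷ b) = just u ∷ b
  fill u (just w ∷ b)  = just w ∷ fill u b

  insert : ∀ {m} → Fin n → Buffer m → Buffer m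
  insert u b = if holds u b then b else fill u b

  size : ∀ {m} → Buffer m → ℕ
  size b = ∑[ w < n ] ind (holds w b)

  holds-fill : ∀ {m} (b : Buffer m) {w u} → w ≢ u → holds w (fill u b) ≡ holds w b
  holds-fill []            w≢u = refl
  holds-fill (nothing ∷ b) {w} {u} w≢u with u Fin.≟ w
  ... | yes refl = contradiction refl w≢u
  ... | no _     = refl
  holds-fill (just x ∷ b)  {w} w≢u = cong (does (x Fin.≟ w) ∨_) (holds-fill b w≢u)

  holds-fill-self : ∀ {m} (b : Buffer m) u → free b ≢ 0 → holds u (fill u b) ≡ true
  holds-fill-self []            u free≢0 = contradiction refl free≢0
  holds-fill-self (nothing ∷ b) u _ with u Fin.≟ u
  ... | yes _  = refl
  ... | no u≢u = contradiction refl u≢u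
  holds-fill-self (just x ∷ b)  u free≢0 rewrite holds-fill-self b u free≢0 = ∨-zeroʳ (does (x Fin.≟ u))

  fill-full : ∀ {m} (b : Buffer m) u → free b ≡ 0 → fill u b ≡ b
  fill-full []           u _      = refl
  fill-full (just x ∷ b) u free≡0 = cong (just x ∷_) (fill-full b u free≡0)

  free-fill : ∀ {m} (b : Buffer m) u {k} → free b ≡ suc k → free (fill u b) ≡ k
  free-fill (nothing ∷ b) u free≡ = suc-injective free≡
  free-fill (just x ∷ b)  u free≡ = free-fill b u free≡

  holds-insert : ∀ {m} (b : Buffer m) {w} u → holds w b ≡ true → holds w (insert u b) ≡ true
  holds-insert b {w} u w∈b with holds u b in u∈b | w Fin.≟ u
  ... | true  | _        = w∈b
  ... | false | yes refl = contradiction (trans (sym w∈b) u∈b) λ ()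
  ... | false | no w≢u   = trans (holds-fill b w≢u) w∈b

  holds-insert⁻ : ∀ {m} (b : Buffer m) {w} u → holds w (insert u b) ≡ true → holds w b ≡ true ⊎ w ≡ u
  holds-insert⁻ b {w} u w∈ with holds u b | w Fin.≟ u
  ... | true  | _        = inj₁ w∈
  ... | false | yes w≡u  = inj₂ w≡u
  ... | false | no w≢u   = inj₁ (trans (sym (holds-fill b w≢u)) w∈)

  insert-full : ∀ {m} (b : Buffer m) u → free b ≡ 0 → free (insert u b) ≡ 0
  insert-full b u free≡0 with holds u b
  ... | true  = free≡0
  ... | false = trans (cong free (fill-full b u free≡0)) free≡0

  insert-self : ∀ {m} (b : Buffer m) u → holds u (insert u b) ≡ true ⊎ free (insert u b) ≡ 0
  insert-self b u with holds u b in u∈b | free b in free≡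
  ... | true  | _     = inj₁ u∈b
  ... | false | zero  = inj₂ (trans (cong free (fill-full b u free≡)) free≡)
  ... | false | suc _ = inj₁ (holds-fill-self b u λ free≡0 → 1+n≢0 (trans (sym free≡) free≡0))

  size+free-insert : ∀ {m} (b : Buffer m) u → size (insert u b) + free (insert u b) ≡ size b + free b
  size+free-insert b u with holds u b in u∉b
  ... | true  = refl
  ... | false with free b in free≡
  ...   | zero  = cong₂ _+_ (cong size (fill-full b u free≡)) (trans (cong free (fill-full b u free≡)) free≡)
  ...   | suc k = begin
    size (fill u b) + free (fill u b) ≡⟨ cong₂ _+_ size-grows (free-fill b u free≡) ⟩
    suc (size b) + k                  ≡⟨ +-suc (size b) k ⟨
    size b + suc k                    ∎
    where
    open ≡-Reasoning
    size-grows : size (fill u b) ≡ suc (size b)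
    size-grows = sum-increment (λ w → ind (holds w b)) (λ w → ind (holds w (fill u b))) u
      (trans (cong ind (holds-fill-self b u λ free≡0 → 1+n≢0 (trans (sym free≡) free≡0)))
             (cong (suc ∘ ind) (sym u∉b))) (λ w w≢u → cong ind (holds-fill b w≢u))

  holds-empty : ∀ m w → holds w (replicate m nothing) ≡ false
  holds-empty zero    w = refl
  holds-empty (suc m) w = holds-empty m w

  free-empty : ∀ m → free (replicate m nothing) ≡ m
  free-empty zero    = refl
  free-empty (suc m) = cong suc (free-empty m)

  size-empty : ∀ m → size (replicate m nothing) ≡ 0
  size-empty m = trans (sum-cong-≗ {n} (λ w → cong ind (holds-empty m w))) (sum-replicate-zero n)

  buffered-edges : ∀ {m} → Fin n → Buffer m → List (Edge n)
  buffered-edges v []            = List.[]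
  buffered-edges v (nothing ∷ b) = buffered-edges v b
  buffered-edges v (just u ∷ b)  = (u , v) List.∷ buffered-edges v b

  holds⇒∈-buffered-edges : ∀ {m} (b : Buffer m) {u} v → holds u b ≡ true → (u , v) ∈ buffered-edges v b
  holds⇒∈-buffered-edges (nothing ∷ b) v u∈b = holds⇒∈-buffered-edges b v u∈b
  holds⇒∈-buffered-edges (just x ∷ b) {u} v u∈b with x Fin.≟ u
  ... | yes refl = here refl
  ... | no _     = there (holds⇒∈-buffered-edges b v u∈b)

  ∈-buffered-edges⇒holds : ∀ {m} (b : Buffer m) {u w} v → (u , w) ∈ buffered-edges v b → w ≡ v × holds u b ≡ true
  ∈-buffered-edges⇒holds (nothing ∷ b) v e∈ = ∈-buffered-edges⇒holds b v e∈
  ∈-buffered-edges⇒holds (just x ∷ b) v (here refl) with x Fin.≟ x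
  ... | yes _  = refl , refl
  ... | no x≢x = contradiction refl x≢x
  ∈-buffered-edges⇒holds (just x ∷ b) {u} v (there e∈) with ∈-buffered-edges⇒holds b v e∈
  ... | w≡v , u∈b = w≡v , trans (cong (does (x Fin.≟ u) ∨_) u∈b) (∨-zeroʳ _)

  stored-edges : ∀ {m} → Vec (Buffer m) n → List (Edge n)
  stored-edges Bs = concatMap (λ v → buffered-edges v (lookup Bs v)) (allFin n)

  holds⇒∈-stored-edges : ∀ {m} (Bs : Vec (Buffer m) n) {u} v → holds u (lookup Bs v) ≡ true → (u , v) ∈ stored-edges Bs
  holds⇒∈-stored-edges Bs v u∈ =
    ∈-concatMap⁺ (λ w → buffered-edges w (lookup Bs w))
      (Any.map (λ { refl → holds⇒∈-buffered-edges (lookup Bs v) v u∈ }) (∈-allFin v))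

  ∈-stored-edges⇒holds : ∀ {m} (Bs : Vec (Buffer m) n) {u v} → (u , v) ∈ stored-edges Bs → holds u (lookup Bs v) ≡ true
  ∈-stored-edges⇒holds Bs e∈ with Any.satisfied (∈-concatMap⁻ (λ w → buffered-edges w (lookup Bs w)) {xs = allFin n} e∈)
  ... | w , e∈w with ∈-buffered-edges⇒holds (lookup Bs w) w e∈w
  ...   | refl , u∈ = u∈

module BFS (n τ : ℕ) where

  -- Labels range over 0 … cap, and cap marks a vertex not reached yet; shortcut-free
  -- walks from s are shorter than cap (degree-sum≤3n), so no true distance is cut off.
  cap : ℕ
  cap = 3 * n

  Tree : Set
  Tree = Vec (Fin (suc cap)) n × Vec (Maybe (Fin n)) n

  Buffers : Set
  Buffers = Vec (Buffer {n} (suc τ)) n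

  State : Set
  State = Tree × Buffers

  label : Tree → Fin n → ℕ
  label t v = toℕ (lookup (proj₁ t) v)

  parent : Tree → Fin n → Maybe (Fin n)
  parent t = lookup (proj₂ t)

  improve : ∀ t u v → suc (label t u) < label t v → Tree
  improve (L , P) u v lt = updateAt L v (λ _ → fromℕ< (<-trans lt (toℕ<n (lookup L v)))) ,
                           updateAt P v (λ _ → just u)

  relax : Fin n → Fin n → Tree → Tree
  relax u v t with suc (label t u) <? label t v
  ... | yes lt = improve t u v lt
  ... | no _   = t

  relaxEdge : Tree → Edge n → Tree
  relaxEdge t (a , b) = relax b a (relax a b t)

  insertEdge : Buffers → Edge n → Buffers
  insertEdge Bs (a , b) = updateAt (updateAt Bs b (insert a)) a (insert b)

  round : Buffers → Tree → Tree
  round Bs t = foldl relaxEdge t (stored-edges Bs)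

  noBuffers : Buffers
  noBuffers = replicate n (replicate (suc τ) nothing)

  initTree : Fin n → Tree
  initTree s = updateAt (replicate n (fromℕ cap)) s (λ _ → Fin.zero) , replicate n nothing

  machine : Machine n State
  machine = record
    { init    = λ s → initTree s , noBuffers
    ; update  = λ st e → relaxEdge (proj₁ st) e , insertEdge (proj₂ st) e
    ; endPass = λ st → fold (proj₁ st) (round (proj₂ st)) cap , noBuffers
    ; output  = parent ∘ proj₁
    }

  pass : List (Edge n) → Tree → Tree
  pass σ t = fold (foldl relaxEdge t σ) (round (foldl insertEdge noBuffers σ)) cap

  run-machine : ∀ p σ t → run machine p σ (t , noBuffers) ≡ (iterate (pass σ) t p , noBuffers)
  run-machine zero    σ t = refl
  run-machine (suc p) σ t rewrite foldl-× relaxEdge insertEdge σ t noBuffers = run-machine p σ (pass σ t)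

  record _⊑_ (t′ t : Tree) : Set where
    constructor labels-≤
    field ≤-at : ∀ v → label t′ v ≤ label t v
  open _⊑_ public

  ⊑-refl : ∀ {t} → t ⊑ t
  ⊑-refl = labels-≤ λ _ → ≤-refl

  ⊑-trans : ∀ {t″ t′ t} → t″ ⊑ t′ → t′ ⊑ t → t″ ⊑ t
  ⊑-trans t″⊑t′ t′⊑t = labels-≤ λ v → ≤-trans (≤-at t″⊑t′ v) (≤-at t′⊑t v)

  module Improve {t u v} (lt : suc (label t u) < label t v) where

    label-improve : label (improve t u v lt) v ≡ suc (label t u)
    label-improve = trans (cong toℕ (lookup∘updateAt v (proj₁ t))) (toℕ-fromℕ< (<-trans lt (toℕ<n (lookup (proj₁ t) v))))

    label-improve′ : ∀ {w} → w ≢ v → label (improve t u v lt) w ≡ label t w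
    label-improve′ w≢v = cong toℕ (lookup∘updateAt′ _ v w≢v (proj₁ t))

    parent-improve : parent (improve t u v lt) v ≡ just u
    parent-improve = lookup∘updateAt v (proj₂ t)

    parent-improve′ : ∀ {w} → w ≢ v → parent (improve t u v lt) w ≡ parent t w
    parent-improve′ w≢v = lookup∘updateAt′ _ v w≢v (proj₂ t)

    improve-⊑ : improve t u v lt ⊑ t
    improve-⊑ = labels-≤ below
      where
      below : ∀ w → label (improve t u v lt) w ≤ label t w
      below w with w Fin.≟ v
      ... | yes refl = ≤-trans (≤-reflexive label-improve) (<⇒≤ lt)
      ... | no  w≢v  = ≤-reflexive (label-improve′ w≢v)

  relax-⊑ : ∀ u v t → relax u v t ⊑ t
  relax-⊑ u v t with suc (label t u) <? label t v
  ... | yes lt = Improve.improve-⊑ {t} {u} {v} lt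
  ... | no  _  = ⊑-refl

  relax-bound : ∀ u v t → label (relax u v t) v ≤ suc (label t u)
  relax-bound u v t with suc (label t u) <? label t v
  ... | yes lt = ≤-reflexive (Improve.label-improve {t} {u} {v} lt)
  ... | no  ¬lt = ≮⇒≥ ¬lt

  relaxEdge-⊑ : ∀ t e → relaxEdge t e ⊑ t
  relaxEdge-⊑ t (a , b) = ⊑-trans (relax-⊑ b a (relax a b t)) (relax-⊑ a b t)

  relaxEdge-bound : ∀ t a b → label (relaxEdge t (a , b)) b ≤ suc (label t a) ×
                              label (relaxEdge t (a , b)) a ≤ suc (label t b)
  relaxEdge-bound t a b = ≤-trans (≤-at (relax-⊑ b a (relax a b t)) b) (relax-bound a b t) ,
                          ≤-trans (relax-bound b a (relax a b t)) (s≤s (≤-at (relax-⊑ a b t) b))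

  foldl-relax-⊑ : ∀ xs t → foldl relaxEdge t xs ⊑ t
  foldl-relax-⊑ List.[]         t = ⊑-refl
  foldl-relax-⊑ (e List.∷ xs) t = ⊑-trans (foldl-relax-⊑ xs (relaxEdge t e)) (relaxEdge-⊑ t e)

  foldl-relax-bound : ∀ {xs a b} t → (a , b) ∈ xs →
                      label (foldl relaxEdge t xs) b ≤ suc (label t a) ×
                      label (foldl relaxEdge t xs) a ≤ suc (label t b)
  foldl-relax-bound {a = a} {b} t ab∈xs with foldl-∈ relaxEdge t ab∈xs
  ... | ys , zs , eq rewrite eq =
    ≤-trans (≤-at (foldl-relax-⊑ zs _) b) (≤-trans (proj₁ (relaxEdge-bound t′ a b)) (s≤s (≤-at (foldl-relax-⊑ ys t) a))) ,
    ≤-trans (≤-at (foldl-relax-⊑ zs _) a) (≤-trans (proj₂ (relaxEdge-bound t′ a b)) (s≤s (≤-at (foldl-relax-⊑ ys t) b)))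
    where t′ = foldl relaxEdge t ys

  foldl-relax-covered : ∀ {xs u v} t → (u , v) ∈ xs ⊎ (v , u) ∈ xs →
                        label (foldl relaxEdge t xs) v ≤ suc (label t u)
  foldl-relax-covered t (inj₁ uv∈xs) = proj₁ (foldl-relax-bound t uv∈xs)
  foldl-relax-covered t (inj₂ vu∈xs) = proj₂ (foldl-relax-bound t vu∈xs)

  rounds-⊑ : ∀ Bs r t → fold t (round Bs) r ⊑ t
  rounds-⊑ Bs zero    t = ⊑-refl
  rounds-⊑ Bs (suc r) t = ⊑-trans (foldl-relax-⊑ (stored-edges Bs) _) (rounds-⊑ Bs r t)

  pass-⊑ : ∀ σ t → pass σ t ⊑ t
  pass-⊑ σ t = ⊑-trans (rounds-⊑ (foldl insertEdge noBuffers σ) cap (foldl relaxEdge t σ)) (foldl-relax-⊑ σ t)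

  rounds-monoʳ-⊑ : ∀ Bs {r r′} t → r ≤ r′ → fold t (round Bs) r′ ⊑ fold t (round Bs) r
  rounds-monoʳ-⊑ Bs {r} {r′} t r≤r′ =
    subst (_⊑ fold t (round Bs) r)
          (trans (sym (fold-+ t (round Bs) (r′ ∸ r))) (cong (fold t (round Bs)) (m∸n+n≡m r≤r′)))
          (rounds-⊑ Bs (r′ ∸ r) (fold t (round Bs) r))

  module Soundness (G : Graph n) (s : Fin n) where

    record Sound (t : Tree) : Set where
      field
        root-label  : label t s ≡ 0
        root-parent : parent t s ≡ nothing
        label-walk  : ∀ v → label t v < cap → Walk G s v (label t v)
        parent-edge : ∀ v → v ≢ s → label t v < cap →
                      ∃[ u ] (parent t v ≡ just u × Adj G u v × suc (label t u) ≤ label t v)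

    improve-sound : ∀ {t u v} (lt : suc (label t u) < label t v) → Adj G u v → Sound t → Sound (improve t u v lt)
    improve-sound {t} {u} {v} lt u~v S = record
      { root-label  = trans (label-improve′ s≢v) root-label
      ; root-parent = trans (parent-improve′ s≢v) root-parent
      ; label-walk  = label-walk′
      ; parent-edge = parent-edge′
      }
      where
      open Sound S
      open Improve {t} {u} {v} lt
      s≢v : s ≢ v
      s≢v refl = n≮0 (subst (suc (label t u) <_) root-label lt)
      u<cap : label t u < cap
      u<cap = <-≤-trans (<-trans (n<1+n _) lt) (s≤s⁻¹ (toℕ<n (lookup (proj₁ t) v)))
      below-cap : ∀ {w} → w ≢ v → label (improve t u v lt) w < cap → label t w < cap
      below-cap w≢v = subst (_< cap) (label-improve′ w≢v)
      label-walk′ : ∀ w → label (improve t u v lt) w < cap → Walk G s w (label (improve t u v lt) w)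
      label-walk′ w w<cap with w Fin.≟ v
      ... | yes refl = subst (Walk G s w) (sym label-improve) (walk-snoc (label-walk u u<cap) u~v)
      ... | no  w≢v  = subst (Walk G s w) (sym (label-improve′ w≢v)) (label-walk w (below-cap w≢v w<cap))
      parent-edge′ : ∀ w → w ≢ s → label (improve t u v lt) w < cap →
                     ∃[ u′ ] (parent (improve t u v lt) w ≡ just u′ × Adj G u′ w ×
                              suc (label (improve t u v lt) u′) ≤ label (improve t u v lt) w)
      parent-edge′ w w≢s w<cap with w Fin.≟ v
      ... | yes refl = u , parent-improve , u~v ,
                       ≤-trans (s≤s (≤-at improve-⊑ u)) (≤-reflexive (sym label-improve))
      ... | no  w≢v with parent-edge w w≢s (below-cap w≢v w<cap)
      ...   | u′ , par , u′~w , u′<w = u′ , trans (parent-improve′ w≢v) par , u′~w ,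
                ≤-trans (s≤s (≤-at improve-⊑ u′)) (≤-trans u′<w (≤-reflexive (sym (label-improve′ w≢v))))

    relax-sound : ∀ {u v t} → Adj G u v → Sound t → Sound (relax u v t)
    relax-sound {u} {v} {t} u~v S with suc (label t u) <? label t v
    ... | yes lt = improve-sound lt u~v S
    ... | no  _  = S

    relaxEdge-sound : ∀ {t a b} → Adj G a b → Sound t → Sound (relaxEdge t (a , b))
    relaxEdge-sound {a = a} {b} a~b S = relax-sound (adj-sym G a~b) (relax-sound a~b S)

    foldl-relax-sound : ∀ {xs t} → All (λ e → Adj G (proj₁ e) (proj₂ e)) xs → Sound t → Sound (foldl relaxEdge t xs)
    foldl-relax-sound adj S = foldl-preserves-All Sound (λ {t} {e} → relaxEdge-sound {t} {proj₁ e} {proj₂ e}) adj S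

    initTree-sound : Sound (initTree s)
    initTree-sound = record
      { root-label  = cong toℕ (lookup∘updateAt s (replicate n (fromℕ cap)))
      ; root-parent = lookup-replicate s nothing
      ; label-walk  = root-walk
      ; parent-edge = λ v v≢s v<cap → contradiction (unreached v≢s) (<⇒≢ v<cap)
      }
      where
      unreached : ∀ {v} → v ≢ s → label (initTree s) v ≡ cap
      unreached {v} v≢s = trans (cong toℕ (trans (lookup∘updateAt′ v s v≢s (replicate n (fromℕ cap)))
                                                 (lookup-replicate v (fromℕ cap))))
                                (toℕ-fromℕ cap)
      root-walk : ∀ v → label (initTree s) v < cap → Walk G s v (label (initTree s) v)
      root-walk v v<cap with v Fin.≟ s
      ... | yes refl = subst (Walk G v v) (sym (cong toℕ (lookup∘updateAt v (replicate n (fromℕ cap))))) here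
      ... | no  v≢s  = contradiction (unreached v≢s) (<⇒≢ v<cap)

  HoldsOrFull : Fin n → Buffer {n} (suc τ) → Set
  HoldsOrFull u b = holds u b ≡ true ⊎ free b ≡ 0

  holdsOrFull-insert : ∀ {u} y b → HoldsOrFull u b → HoldsOrFull u (insert y b)
  holdsOrFull-insert y b = Sum.map (holds-insert b y) (insert-full b y)

  Retains : Fin n → Fin n → Buffers → Set
  Retains u v Bs = HoldsOrFull u (lookup Bs v)

  retains-insertEdge : ∀ {u v} Bs e → Retains u v Bs → Retains u v (insertEdge Bs e)
  retains-insertEdge {u} {v} Bs (a , b) =
    updateAt-preserves (HoldsOrFull u) (updateAt Bs b (insert a)) a v (holdsOrFull-insert b) ∘
    updateAt-preserves (HoldsOrFull u) Bs b v (holdsOrFull-insert a)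

  insertEdge-retains : ∀ Bs a b → Retains a b (insertEdge Bs (a , b)) × Retains b a (insertEdge Bs (a , b))
  insertEdge-retains Bs a b =
    updateAt-preserves (HoldsOrFull a) Bs₁ a b (holdsOrFull-insert b)
      (subst (HoldsOrFull a) (sym (lookup∘updateAt b Bs)) (insert-self (lookup Bs b) a)) ,
    subst (HoldsOrFull b) (sym (lookup∘updateAt a Bs₁)) (insert-self (lookup Bs₁ a) b)
    where Bs₁ = updateAt Bs b (insert a)

  foldl-insert-retains : ∀ {xs u v} Bs → (u , v) ∈ xs ⊎ (v , u) ∈ xs → Retains u v (foldl insertEdge Bs xs)
  foldl-insert-retains Bs (inj₁ uv∈xs) with foldl-∈ insertEdge Bs uv∈xs
  ... | ys , zs , eq rewrite eq =
    foldl-preserves (Retains _ _) retains-insertEdge zs (proj₁ (insertEdge-retains (foldl insertEdge Bs ys) _ _))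
  foldl-insert-retains Bs (inj₂ vu∈xs) with foldl-∈ insertEdge Bs vu∈xs
  ... | ys , zs , eq rewrite eq =
    foldl-preserves (Retains _ _) retains-insertEdge zs (proj₂ (insertEdge-retains (foldl insertEdge Bs ys) _ _))

  module WellFormedness (G : Graph n) where

    BufferOK : Fin n → Buffer {n} (suc τ) → Set
    BufferOK v b = (∀ w → holds w b ≡ true → Adj G w v) × size b + free b ≡ suc τ

    WellFormed : Buffers → Set
    WellFormed Bs = ∀ v → BufferOK v (lookup Bs v)

    insert-OK : ∀ {u v} b → Adj G u v → BufferOK v b → BufferOK v (insert u b)
    insert-OK {u} b u~v (adjacent , count) =
      (λ w w∈ → Sum.[ adjacent w , (λ { refl → u~v }) ] (holds-insert⁻ b u w∈)) ,
      trans (size+free-insert b u) count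

    insertEdge-wf : ∀ {Bs a b} → Adj G a b → WellFormed Bs → WellFormed (insertEdge Bs (a , b))
    insertEdge-wf {Bs} {a} {b} a~b wf =
      updateAt-pointwise BufferOK Bs₁ a wf₁ (insert-OK (lookup Bs₁ a) (adj-sym G a~b) (wf₁ a))
      where
      Bs₁ = updateAt Bs b (insert a)
      wf₁ : WellFormed Bs₁
      wf₁ = updateAt-pointwise BufferOK Bs b wf (insert-OK (lookup Bs b) a~b (wf b))

    noBuffers-wf : WellFormed noBuffers
    noBuffers-wf v rewrite lookup-replicate v (replicate (suc τ) (nothing {A = Fin n})) =
      (λ w w∈ → contradiction (trans (sym w∈) (holds-empty (suc τ) w)) λ ()) ,
      cong₂ _+_ (size-empty {n} (suc τ)) (free-empty {n} (suc τ))

    full⇒large-degree : ∀ {Bs v} → WellFormed Bs → free (lookup Bs v) ≡ 0 → suc τ ≤ degree G v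
    full⇒large-degree {Bs} {v} wf full = begin
      suc τ           ≡⟨ proj₂ (wf v) ⟨
      size b + free b ≡⟨ cong (size b +_) full ⟩
      size b + 0      ≡⟨ +-identityʳ (size b) ⟩
      size b          ≤⟨ sum-mono-≤ held⇒adjacent ⟩
      degree G v      ∎
      where
      open ≤-Reasoning
      b = lookup Bs v
      held⇒adjacent : ∀ w → ind (holds w b) ≤ ind (Graph.adj G w v)
      held⇒adjacent w with holds w b in w∈b
      ... | false = z≤n
      ... | true  = ≤-reflexive (sym (T⇒ind≡1 (proj₁ (wf v) w w∈b)))

module Correctness {n τ : ℕ} (G : Graph n) (s : Fin n) (σ : List (Edge n)) (stream : IsEdgeStream G σ)
                   (p : ℕ) (enough-passes : 3 * n < suc τ * p) where
  open BFS n τ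
  open Soundness G s
  open WellFormedness G

  σ-adjacent : All (λ e → Adj G (proj₁ e) (proj₂ e)) σ
  σ-adjacent = proj₁ stream

  σ-covers : ∀ u v → Adj G u v → (u , v) ∈ σ ⊎ (v , u) ∈ σ
  σ-covers = proj₁ (proj₂ stream)

  buffers : Buffers
  buffers = foldl insertEdge noBuffers σ

  buffers-wf : WellFormed buffers
  buffers-wf = foldl-preserves-All WellFormed (λ {Bs} {e} → insertEdge-wf {Bs} {proj₁ e} {proj₂ e}) σ-adjacent noBuffers-wf

  stored-adjacent : All (λ e → Adj G (proj₁ e) (proj₂ e)) (stored-edges buffers)
  stored-adjacent = All.tabulate λ { {u , v} e∈ → proj₁ (buffers-wf v) u (∈-stored-edges⇒holds buffers e∈) }

  tree : ℕ → Tree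
  tree t = fold (initTree s) (pass σ) t

  tree-sound : ∀ t → Sound (tree t)
  tree-sound zero    = initTree-sound
  tree-sound (suc t) = rounds-sound cap (foldl-relax-sound σ-adjacent (tree-sound t))
    where
    rounds-sound : ∀ r {t} → Sound t → Sound (fold t (round buffers) r)
    rounds-sound zero    S = S
    rounds-sound (suc r) S = foldl-relax-sound stored-adjacent (rounds-sound r S)

  stream-step : ∀ t {u v} → Adj G u v → label (foldl relaxEdge t σ) v ≤ suc (label t u)
  stream-step t {u} {v} u~v = foldl-relax-covered t (σ-covers u v u~v)

  Full : Fin n → Set
  Full v = free (lookup buffers v) ≡ 0

  full? : ∀ v → Dec (Full v)
  full? v = free (lookup buffers v) ≟ 0

  round-step : ∀ t {u v} → Adj G u v → ¬ Full u ⊎ ¬ Full v → label (round buffers t) v ≤ suc (label t u)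
  round-step t {u} {v} u~v (inj₂ ¬full-v) with foldl-insert-retains noBuffers (σ-covers u v u~v)
  ... | inj₁ u∈v    = foldl-relax-covered t (inj₁ (holds⇒∈-stored-edges buffers v u∈v))
  ... | inj₂ full-v = contradiction full-v ¬full-v
  round-step t {u} {v} u~v (inj₁ ¬full-u) with foldl-insert-retains noBuffers (σ-covers v u (adj-sym G u~v))
  ... | inj₁ v∈u    = foldl-relax-covered t (inj₂ (holds⇒∈-stored-edges buffers u v∈u))
  ... | inj₂ full-u = contradiction full-u ¬full-u

  0<cap : 0 < cap
  0<cap = ≤-trans (≤-<-trans z≤n (toℕ<n s)) (m≤m+n n (2 * n))


  module Along {v k} (W : IndexedWalk G s v k) (no-shortcut : ShortcutFree G W) where

    x : ℕ → Fin n
    x = at W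

    heavy : ℕ → ℕ
    heavy i = ind (free (lookup buffers (x i)) ≡ᵇ 0)

    full⇒heavy : ∀ {i} → Full (x i) → heavy i ≡ 1
    full⇒heavy full = cong (λ m → ind (m ≡ᵇ 0)) full

    heavy-count<p : sumTo (suc k) heavy < p
    heavy-count<p = *-cancelʳ-< (suc τ) (sumTo (suc k) heavy) p (begin-strict
      sumTo (suc k) heavy * suc τ             ≡⟨ sum-*ʳ {suc k} (heavy ∘ toℕ) (suc τ) ⟩
      ∑[ i < suc k ] (heavy (toℕ i) * suc τ) ≤⟨ sum-mono-≤ {suc k} (λ i → heavy≤degree (toℕ i)) ⟩
      sumTo (suc k) (degree G ∘ x)            ≤⟨ degree-sum≤3n G W no-shortcut ⟩
      3 * n                                   <⟨ enough-passes ⟩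
      suc τ * p                               ≡⟨ *-comm (suc τ) p ⟩
      p * suc τ                               ∎)
      where
      open ≤-Reasoning
      heavy≤degree : ∀ i → heavy i * suc τ ≤ degree G (x i)
      heavy≤degree i with free (lookup buffers (x i)) in full
      ... | zero  = ≤-trans (≤-reflexive (+-identityʳ (suc τ))) (full⇒large-degree {buffers} buffers-wf full)
      ... | suc _ = z≤n

    length<cap : k < cap
    length<cap with 1 ≤? k
    ... | yes 1≤k = <-≤-trans (length<degree-sum G W 1≤k) (degree-sum≤3n G W no-shortcut)
    ... | no  k≱1 = subst (_< cap) (sym (n<1⇒n≡0 (≰⇒> k≱1))) 0<cap

    Light : ℕ → Set
    Light j = ¬ Full (x j) ⊎ ¬ Full (x (suc j))

    light? : ∀ j → Dec (Light j)
    light? j = ¬? (full? (x j)) ⊎-dec ¬? (full? (x (suc j)))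

    rounds-along : ∀ r t a → (∀ j → a ≤ j → j < a + r → Light j) → a + r ≤ k →
                   label (fold t (round buffers) r) (x (a + r)) ≤ label t (x a) + r
    rounds-along zero    t a _     _ rewrite +-identityʳ a | +-identityʳ (label t (x a)) = ≤-refl
    rounds-along (suc r) t a light a+r<k rewrite +-suc a r | +-suc (label t (x a)) r =
      ≤-trans (round-step _ (adj-at W (a + r) a+r<k) (light (a + r) (m≤m+n a r) ≤-refl))
              (s≤s (rounds-along r t a (λ j a≤j j< → light j a≤j (m<n⇒m<1+n j<)) (<⇒≤ a+r<k)))

    next-block : ∀ q d → q + d ≡ k →
                 ∃ λ r → q + r ≤ k × (∀ j → q ≤ j → j < q + r → Light j) × (q + r ≡ k ⊎ Full (x (q + r)))
    next-block q zero    q+0≡k = 0 , ≤-reflexive q+0≡k , (λ j q≤j j< → ⊥-elim (q≤j⇒j≮q+0 q≤j j<)) , inj₁ q+0≡k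
    next-block q (suc d) q+d≡k with light? q
    ... | no ¬light =
      0 , ≤-trans (≤-reflexive (+-identityʳ q)) (subst (q ≤_) q+d≡k (m≤m+n q (suc d))) ,
      (λ j q≤j j< → ⊥-elim (q≤j⇒j≮q+0 q≤j j<)) ,
      inj₂ (subst (Full ∘ x) (sym (+-identityʳ q)) (decidable-stable (full? (x q)) (¬light ∘ inj₁)))
    ... | yes light with next-block (suc q) d (trans (sym (+-suc q d)) q+d≡k)
    ...   | r , bound , lights , end =
      suc r , subst (_≤ k) (sym (+-suc q r)) bound , lights′ ,
      subst (λ m → m ≡ k ⊎ Full (x m)) (sym (+-suc q r)) end
      where
      lights′ : ∀ j → q ≤ j → j < q + suc r → Light j
      lights′ j q≤j j< with m≤n⇒m<n∨m≡n q≤j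
      ... | inj₂ refl = light
      ... | inj₁ q<j  = lights j q<j (subst (j <_) (+-suc q r) j<)

    pass-advance : ∀ t i → label t (x i) ≤ i → i < k →
                   ∃ λ i′ → i < i′ × i′ ≤ k × label (pass σ t) (x i′) ≤ i′ × (i′ ≡ k ⊎ Full (x i′))
    pass-advance t i settled i<k with next-block (suc i) (k ∸ suc i) (m+[n∸m]≡n i<k)
    ... | r , i′≤k , lights , end = suc i + r , s≤s (m≤m+n i r) , i′≤k , settled′ , end
      where
      mid = foldl relaxEdge t σ
      r≤cap : r ≤ cap
      r≤cap = ≤-trans (m≤n+m r (suc i)) (≤-trans i′≤k (<⇒≤ length<cap))
      settled′ : label (pass σ t) (x (suc i + r)) ≤ suc i + r
      settled′ = begin
        label (pass σ t) (x (suc i + r))                   ≤⟨ ≤-at (rounds-monoʳ-⊑ buffers mid r≤cap) (x (suc i + r)) ⟩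
        label (fold mid (round buffers) r) (x (suc i + r)) ≤⟨ rounds-along r mid (suc i) lights i′≤k ⟩
        label mid (x (suc i)) + r                          ≤⟨ +-monoˡ-≤ r (≤-trans (stream-step t (adj-at W i i<k)) (s≤s settled)) ⟩
        suc i + r                                          ∎
        where open ≤-Reasoning

    Frontier : ℕ → Set
    Frontier t = ∃ λ i → i ≤ k × label (tree t) (x i) ≤ i × (i ≡ k ⊎ t ≤ sumTo (suc i) heavy)

    frontier : ∀ t → Frontier t
    frontier zero = 0 , z≤n , ≤-reflexive root-settled , inj₂ z≤n
      where
      root-settled : label (initTree s) (x 0) ≡ 0
      root-settled = trans (cong (label (initTree s)) (at-0 W)) (Sound.root-label initTree-sound)
    frontier (suc t) with frontier t
    ... | i , i≤k , settled , reached with m≤n⇒m<n∨m≡n i≤k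
    ...   | inj₂ refl = i , i≤k , ≤-trans (≤-at (pass-⊑ σ (tree t)) (x i)) settled , inj₁ refl
    ...   | inj₁ i<k with reached | pass-advance (tree t) i settled i<k
    ...     | inj₁ i≡k | _ = contradiction i≡k (<⇒≢ i<k)
    ...     | inj₂ _   | i′ , _   , i′≤k , settled′ , inj₁ i′≡k = i′ , i′≤k , settled′ , inj₁ i′≡k
    ...     | inj₂ t≤  | i′ , i<i′ , i′≤k , settled′ , inj₂ full = i′ , i′≤k , settled′ , inj₂ (begin
              suc t                        ≤⟨ s≤s (≤-trans t≤ (sumTo-monoˡ-≤ heavy i<i′)) ⟩
              suc (sumTo i′ heavy)         ≡⟨ +-comm 1 _ ⟩
              sumTo i′ heavy + 1           ≡⟨ cong (sumTo i′ heavy +_) (full⇒heavy full) ⟨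
              sumTo i′ heavy + heavy i′    ≡⟨ sumTo-suc i′ heavy ⟨
              sumTo (suc i′) heavy         ∎)
      where open ≤-Reasoning

    reaches : label (tree p) v ≤ k
    reaches with frontier p
    ... | i , _   , settled , inj₁ refl = subst (λ w → label (tree p) w ≤ i) (at-k W) settled
    ... | i , i≤k , _       , inj₂ p≤   = contradiction (≤-trans p≤ (sumTo-monoˡ-≤ heavy (s≤s i≤k))) (<⇒≱ heavy-count<p)

  complete : ∀ k {v} → IndexedWalk G s v k → label (tree p) v ≤ k × label (tree p) v < cap
  complete = <-rec _ go
    where
    go : ∀ k → (∀ {k′} → k′ < k → ∀ {v} → IndexedWalk G s v k′ → label (tree p) v ≤ k′ × label (tree p) v < cap) →
         ∀ {v} → IndexedWalk G s v k → label (tree p) v ≤ k × label (tree p) v < cap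
    go k shorter W with shortcut? G W
    ... | no  no-shortcut = reaches , ≤-<-trans reaches length<cap
      where open Along W no-shortcut
    ... | yes shortcut with shorten G W shortcut
    ...   | k′ , k′<k , W′ = Product.map₁ (λ ≤k′ → ≤-trans ≤k′ (<⇒≤ k′<k)) (shorter k′<k W′)

  bfs-tree : Connected G → IsBFSTree G s (parent (tree p))
  bfs-tree connected = Sound.root-parent S , tree-edge
    where
    S = tree-sound p
    reached : ∀ v → label (tree p) v < cap
    reached v = proj₂ (complete _ (toIndexed G (proj₂ (connected s v))))
    distance : ∀ v → IsDist G s v (label (tree p) v)
    distance v = Sound.label-walk S v (reached v) , λ k W → proj₁ (complete k (toIndexed G W))
    tree-edge : ∀ v → v ≢ s → ∃[ u ] (parent (tree p) v ≡ just u × Adj G u v ×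
                                      ∃[ d ] (IsDist G s u d × IsDist G s v (suc d)))
    tree-edge v v≢s with Sound.parent-edge S v v≢s (reached v)
    ... | u , par , u~v , u<v = u , par , u~v , label (tree p) u , distance u ,
          walk-snoc (proj₁ (distance u)) u~v , λ k W → ≤-trans u<v (proj₂ (distance v) k W)

machine-computes-BFS : ∀ {n τ p} → 3 * n < suc τ * p → MachineComputesBFS (BFS.machine n τ) p
machine-computes-BFS {n} {τ} {p} enough-passes G s σ connected stream =
  subst (IsBFSTree G s) (sym output≡) (bfs-tree connected)
  where
  open BFS n τ
  open Correctness {n} {τ} G s σ stream p enough-passes
  output≡ : parent (proj₁ (run machine p σ (initTree s , noBuffers))) ≡ parent (tree p)
  output≡ = trans (cong (parent ∘ proj₁) (run-machine p σ (initTree s)))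
                  (cong parent (sym (iterate-is-fold (initTree s) (pass σ) p)))

m<[1+m/n]*n : ∀ m n .{{_ : NonZero n}} → m < suc (m / n) * n
m<[1+m/n]*n m n = begin-strict
  m                 ≡⟨ m≡m%n+[m/n]*n m n ⟩
  m % n + m / n * n <⟨ +-monoˡ-< (m / n * n) (m%n<n m n) ⟩
  n + m / n * n     ∎
  where open ≤-Reasoning

m≤1+2⌊m/2⌋ : ∀ m → m ≤ suc (⌊ m /2⌋ + ⌊ m /2⌋)
m≤1+2⌊m/2⌋ zero          = z≤n
m≤1+2⌊m/2⌋ (suc zero)    = s≤s z≤n
m≤1+2⌊m/2⌋ (suc (suc m)) = s≤s (≤-trans (s≤s (m≤1+2⌊m/2⌋ m)) (≤-reflexive (cong suc (sym (+-suc ⌊ m /2⌋ ⌊ m /2⌋)))))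

m<2^[1+⌊log₂m⌋] : ∀ m → m < 2 ^ suc ⌊log₂ m ⌋
m<2^[1+⌊log₂m⌋] = <-rec (λ m → m < 2 ^ suc ⌊log₂ m ⌋) go
  where
  go : ∀ m → (∀ {m′} → m′ < m → m′ < 2 ^ suc ⌊log₂ m′ ⌋) → m < 2 ^ suc ⌊log₂ m ⌋
  go zero          _   = s≤s z≤n
  go (suc zero)    _   = s≤s (s≤s z≤n)
  go (suc (suc m)) rec = begin-strict
    suc (suc m)   ≤⟨ m≤1+2⌊m/2⌋ (suc (suc m)) ⟩
    suc (h + h)   <⟨ s≤s (+-monoʳ-< h (n<1+n h)) ⟩
    suc h + suc h ≤⟨ +-mono-≤ ih ih ⟩
    2 ^ L + 2 ^ L ≡⟨ cong (2 ^ L +_) (+-identityʳ (2 ^ L)) ⟨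
    2 ^ suc L     ∎
    where
    open ≤-Reasoning
    h = ⌊ suc (suc m) /2⌋
    L = ⌊log₂ suc (suc m) ⌋
    1≤L : 1 ≤ L
    1≤L = subst (_≤ L) (⌊log₂[2^n]⌋≡n 1) (⌊log₂⌋-mono-≤ {2} {suc (suc m)} (s≤s (s≤s z≤n)))
    ih : suc h ≤ 2 ^ L
    ih = subst (λ e → suc h ≤ 2 ^ e)
               (trans (cong suc (⌊log₂⌊n/2⌋⌋≡⌊log₂n⌋∸1 (suc (suc m)))) (m+[n∸m]≡n 1≤L))
               (rec (⌊n/2⌋<n (suc m)))

bits : ℕ → ℕ
bits n = 2 + suc ⌊log₂ n ⌋

1+3n≤2^bits : ∀ n → suc (3 * n) ≤ 2 ^ bits n
1+3n≤2^bits n = begin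
  suc (3 * n)               ≤⟨ m≤m+n (suc (3 * n)) (3 + n) ⟩
  suc (3 * n) + (3 + n)     ≡⟨ solve 1 (λ n → (con 1 :+ con 3 :* n) :+ (con 3 :+ n) := con 4 :* (con 1 :+ n)) refl n ⟩
  4 * suc n                 ≤⟨ *-monoʳ-≤ 4 (m<2^[1+⌊log₂m⌋] n) ⟩
  4 * 2 ^ suc ⌊log₂ n ⌋     ≡⟨ solve 1 (λ x → con 4 :* x := con 2 :* (con 2 :* x)) refl (2 ^ suc ⌊log₂ n ⌋) ⟩
  2 ^ bits n                ∎
  where open ≤-Reasoning

stateBits : ℕ → ℕ → ℕ → ℕ
stateBits n τ B = (n * B + n * B) + n * (suc τ * B)

state-encoding : ∀ {n τ B} → suc (3 * n) ≤ 2 ^ B → Encoding (BFS.State n τ) (stateBits n τ B)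
state-encoding {n} {τ} {B} fits =
  ×-encoding (×-encoding (vec-encoding n (fin-encoding B fits)) (vec-encoding n vertex))
             (vec-encoding n (vec-encoding (suc τ) vertex))
  where
  vertex = maybe-encoding B (≤-trans (s≤s (m≤n*m n 3)) fits)

space-bound : ∀ n p .{{_ : NonZero p}} → p ≤ n → stateBits n (3 * n / p) (bits n) * p ≤ 18 * (n * n) * polylog 1 n
space-bound n p p≤n = begin
  stateBits n τ B * p             ≡⟨ solve 4 (λ n B τ p → ((n :* B :+ n :* B) :+ n :* ((con 1 :+ τ) :* B)) :* p
                                                   := n :* B :* (τ :* p :+ con 3 :* p)) refl n B τ p ⟩
  n * B * (τ * p + 3 * p)         ≤⟨ *-monoʳ-≤ (n * B) (+-mono-≤ (m/n*n≤m (3 * n) p) (*-monoʳ-≤ 3 p≤n)) ⟩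
  n * B * (3 * n + 3 * n)         ≤⟨ *-monoˡ-≤ (3 * n + 3 * n) (*-monoʳ-≤ n B≤3ℓ) ⟩
  n * (3 * ℓ) * (3 * n + 3 * n)   ≡⟨ solve 2 (λ n ℓ → n :* (con 3 :* ℓ) :* (con 3 :* n :+ con 3 :* n)
                                                   := con 18 :* (n :* n) :* (ℓ :* con 1)) refl n ℓ ⟩
  18 * (n * n) * polylog 1 n      ∎
  where
  open ≤-Reasoning
  τ = 3 * n / p
  ℓ = suc ⌊log₂ n ⌋
  B = bits n
  B≤3ℓ : B ≤ 3 * ℓ
  B≤3ℓ = ≤-trans (≤-reflexive (+-comm 2 ℓ)) (+-monoʳ-≤ ℓ (*-monoʳ-≤ 2 (s≤s z≤n)))

bfs-in-p-passes : (n p : ℕ) → 1 ≤ p → p ≤ n →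
                  ∃[ S ] (S * p ≤ 18 * (n * n) * polylog 1 n × Σ (StreamAlg n S) (λ A → ComputesBFS A p))
bfs-in-p-passes n p@(suc _) _ p≤n =
  stateBits n τ (bits n) , space-bound n p p≤n ,
  compile machine E , compile-computesBFS machine E {p} (machine-computes-BFS {n} {τ} {p} (m<[1+m/n]*n (3 * n) p))
  where
  τ = 3 * n / p
  open BFS n τ using (machine)
  E = state-encoding {n} {τ} (1+3n≤2^bits n)

theorem9 : ∃[ c ] ∃[ k ] ((n p : ℕ) → 1 ≤ p → p ≤ n →
             ∃[ S ] (S * p ≤ c * (n * n) * polylog k n ×
                     Σ (StreamAlg n S) (λ A → ComputesBFS A p)))
theorem9 = 18 , 1 , bfs-in-p-passes
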